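{- Let $G$ be a graph with an effective competition cover. Then $k(G)=\theta_e(G)-|V(G)|+p(G)$.
   Context: All graphs are finite and simple; digraphs are finite, without loops or multiple arcs. A clique is a vertex set inducing a complete subgraph; it covers an edge if it contains both ends. The competition graph $C(D)$ of a digraph $D$ has vertex set $V(D)$, and distinct $x,y$ are adjacent iff some $z$ has arcs $(x,z),(y,z)$ in $D$. The competition number $k(G)$ is the smallest $k\ge0$ such that $G$ together with $k$ new isolated vertices is the competition graph of an acyclic digraph. The primary predator index $p(G)$ is the maximum, over all acyclic digraphs $D$ whose competition graph is $G$ together with $k(G)$ isolated vertices, of the number of in-degree-$0$ vertices of $D$. An edge clique cover is a family of cliques covering all edges; $\theta_e(G)$ is the minimum size of one; a minimum edge clique cover has size $\theta_e(G)$. For $G$ with at least one edge, a minimum edge clique cover $\mathcal{C}=\{C_1,\dots,C_{\theta_e(G)}\}$ is an effective competition cover if every $C_i$ is a maximal clique and there is an acyclic digraph $D$ whose competition graph is $G$ together with $k(G)$ isolated vertices, such that the set of vertices of nonzero in-degree of $D$ is $\{w_1,\dots,w_{\theta_e(G)}\}$ where each $w_i$ is a common out-neighbor of all vertices of $C_i$. -}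

module Defs where

open import Data.Nat using (ℕ; zero; suc; _+_; _≤_)
open import Data.Bool using (Bool; true; false; T; not; if_then_else_)
open import Data.Fin using (Fin; _↑ˡ_; splitAt)
open import Data.Fin.Subset using (Subset; _∈_; _∉_; _⊆_)
open import Data.List using (List; allFin)
open import Data.Sum using (_⊎_; inj₁; inj₂)
open import Data.Product using (Σ; ∃; ∃-syntax; _×_; _,_)
open import Relation.Binary.PropositionalEquality using (_≡_; _≢_)
open import Relation.Nullary using (¬_)
open import Data.Empty using (⊥)
open import Relation.Binary.Construct.Closure.Transitive using (TransClosure)
open import Function.Bundles using (_⇔_)

record Graph (n : ℕ) : Set where
  field
    adj   : Fin n → Fin n → Bool
    sym   : ∀ x y → adj x y ≡ adj y x
    irrefl : ∀ x → adj x x ≡ false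
open Graph public

Adj : ∀ {n} → Graph n → Fin n → Fin n → Set
Adj G x y = T (adj G x y)

record Digraph (m : ℕ) : Set where
  field
    arc      : Fin m → Fin m → Bool
    loopless : ∀ x → arc x x ≡ false
open Digraph public

Arc : ∀ {m} → Digraph m → Fin m → Fin m → Set
Arc D x y = T (arc D x y)

Acyclic : ∀ {m} → Digraph m → Set
Acyclic D = ∀ x → ¬ TransClosure (Arc D) x x

CompAdj : ∀ {m} → Digraph m → Fin m → Fin m → Set
CompAdj D x y = x ≢ y × ∃[ z ] (Arc D x z × Arc D y z)

-- G together with k new isolated vertices: vertex set Fin (n + k), where
-- _↑ˡ k embeds the original vertices and the last k vertices are the new ones.
AdjIso : ∀ {n} → Graph n → (k : ℕ) → Fin (n + k) → Fin (n + k) → Set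
AdjIso {n} G k x y with splitAt n x | splitAt n y
... | inj₁ a | inj₁ b = Adj G a b
... | inj₁ _ | inj₂ _ = ⊥
... | inj₂ _ | _      = ⊥

CompGraphIs : ∀ {n} → (k : ℕ) → Digraph (n + k) → Graph n → Set
CompGraphIs k D G = ∀ x y → (CompAdj D x y ⇔ AdjIso G k x y)

Realizes : ∀ {n} → Graph n → (k : ℕ) → Digraph (n + k) → Set
Realizes G k D = Acyclic D × CompGraphIs k D G

IsCompetitionNumber : ∀ {n} → Graph n → ℕ → Set
IsCompetitionNumber G k =
  (∃[ D ] Realizes G k D) × (∀ j → (∃[ D ] Realizes G j D) → k ≤ j)

countB : ∀ {A : Set} → (A → Bool) → List A → ℕ
countB f List.[] = 0
countB f (x List.∷ xs) = (if f x then 1 else 0) + countB f xs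

allB : ∀ {A : Set} → (A → Bool) → List A → Bool
allB f List.[] = true
allB f (x List.∷ xs) = if f x then allB f xs else false

inDeg0 : ∀ {m} → Digraph m → Fin m → Bool
inDeg0 {m} D x = allB (λ y → not (arc D y x)) (allFin m)

numSources : ∀ {m} → Digraph m → ℕ
numSources {m} D = countB (inDeg0 D) (allFin m)

IsPrimaryPredatorIndex : ∀ {n} → Graph n → (k p : ℕ) → Set
IsPrimaryPredatorIndex G k p =
  (∃[ D ] (Realizes G k D × numSources D ≡ p)) ×
  (∀ D → Realizes G k D → numSources D ≤ p)

IsClique : ∀ {n} → Graph n → Subset n → Set
IsClique G C = ∀ x y → x ∈ C → y ∈ C → x ≢ y → Adj G x y

IsMaximalClique : ∀ {n} → Graph n → Subset n → Set
IsMaximalClique G C = IsClique G C × (∀ C′ → IsClique G C′ → C ⊆ C′ → C′ ⊆ C)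

IsEdgeCliqueCover : ∀ {n} → Graph n → (t : ℕ) → (Fin t → Subset n) → Set
IsEdgeCliqueCover G t C =
  (∀ i → IsClique G (C i)) × (∀ x y → Adj G x y → ∃[ i ] (x ∈ C i × y ∈ C i))

IsEdgeCliqueCoverNumber : ∀ {n} → Graph n → ℕ → Set
IsEdgeCliqueCoverNumber G t =
  (∃[ C ] IsEdgeCliqueCover G t C) ×
  (∀ s (C : Fin s → Subset _) → IsEdgeCliqueCover G s C → t ≤ s)

HasEdge : ∀ {n} → Graph n → Set
HasEdge G = ∃[ x ] ∃[ y ] Adj G x y

IsEffectiveCompetitionCover : ∀ {n} → Graph n → (k t : ℕ) → (Fin t → Subset n) → Set
IsEffectiveCompetitionCover {n} G k t C =
  HasEdge G ×
  IsEdgeCliqueCover G t C ×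
  (∀ i → IsMaximalClique G (C i)) ×
  Σ (Digraph (n + k)) λ D → Σ (Fin t → Fin (n + k)) λ w → (Realizes G k D ×
    (∀ v → ((inDeg0 D v ≡ false) ⇔ (∃[ i ] (w i ≡ v)))) ×
    (∀ i x → x ∈ C i → Arc D (x ↑ˡ k) (w i)))

HasEffectiveCompetitionCover : ∀ {n} → Graph n → (k t : ℕ) → Set
HasEffectiveCompetitionCover G k t = ∃[ C ] IsEffectiveCompetitionCover G k t C

module Submission where

-- For an acyclic digraph D realising G ∪ I_k (on n + k vertices)
-- split the vertices into sources (in-degree 0) and non-sources, so that
--   numSources D + #non-sources of D = n + k.
-- (1) For EVERY realiser D, the in-neighbourhoods of the non-sources, restricted
--     to V(G), form an edge clique cover of G; hence θ_e(G) = t ≤ #non-sources,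
--     and taking D with numSources D = p(G) gives t + p ≤ n + k.
-- (2) For the realiser D of the effective competition cover, the non-sources are
--     among w₁, …, w_t, so #non-sources ≤ t; as numSources D ≤ p by
--     maximality of p, we get n + k ≤ t + p.
-- Hence t + p = n + k, i.e. k = t − n + p in ℤ.

open import Defs
open import Data.Nat using (ℕ)
open import Data.Integer using (+_; -_; _+_; _-_)
open import Relation.Binary.PropositionalEquality using (_≡_)

open import Data.Nat as ℕ using (zero; suc; _≤_)
import Data.Nat.Properties as ℕP
import Data.Integer.Properties as ℤP
open import Data.Bool using (Bool; true; false; not)
open import Data.Bool.Properties using (T-≡; not-¬; not-injective)
open import Data.Fin using (Fin; _↑ˡ_)
open import Data.Fin.Properties using (suc-injective; injective⇒≤; splitAt-↑ˡ; ↑ˡ-injective)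
open import Data.Fin.Subset using (Subset; _∈_)
open import Data.List using (tabulate; allFin)
import Data.Vec as Vec
open import Data.Vec.Properties using (lookup∘tabulate; []=⇒lookup; lookup⇒[]=)
open import Data.Product using (∃-syntax; _×_; _,_; proj₁; proj₂)
open import Data.Empty using (⊥-elim)
open import Function.Definitions using (Injective)
open import Function.Bundles using (_⇔_; Equivalence)
open import Relation.Binary.PropositionalEquality
  using (refl; trans; cong; module ≡-Reasoning) renaming (sym to ≡-sym)

record Enumeration {A : Set} (m : ℕ) (g : Fin m → A) (h : A → Bool) (c : ℕ) : Set where
  field
    index     : Fin c → Fin m
    injective : Injective _≡_ _≡_ index
    sound     : ∀ i → h (g (index i)) ≡ true
    complete  : ∀ x → h (g x) ≡ true → ∃[ i ] index i ≡ x

enumerate : ∀ {A : Set} m (g : Fin m → A) (h : A → Bool) →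
  Enumeration m g h (countB h (tabulate g))
enumerate zero g h = record
  { index = λ () ; injective = λ {} ; sound = λ () ; complete = λ () }
enumerate (suc m) g h with enumerate m (λ i → g (Fin.suc i)) h | h (g Fin.zero) in g₀
... | E | true = record
  { index = index′ ; injective = injective′ ; sound = sound′ ; complete = complete′ }
  where
  open Enumeration E
  index′ : Fin (suc (countB h (tabulate (λ i → g (Fin.suc i))))) → Fin (suc m)
  index′ Fin.zero    = Fin.zero
  index′ (Fin.suc i) = Fin.suc (index i)
  injective′ : Injective _≡_ _≡_ index′
  injective′ {Fin.zero}  {Fin.zero}  _ = refl
  injective′ {Fin.suc i} {Fin.suc j} p = cong Fin.suc (injective (suc-injective p))
  sound′ : ∀ i → h (g (index′ i)) ≡ true
  sound′ Fin.zero    = g₀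
  sound′ (Fin.suc i) = sound i
  complete′ : ∀ x → h (g x) ≡ true → ∃[ i ] index′ i ≡ x
  complete′ Fin.zero    _ = Fin.zero , refl
  complete′ (Fin.suc x) p with complete x p
  ... | i , refl = Fin.suc i , refl
... | E | false = record
  { index = λ i → Fin.suc (index i)
  ; injective = λ p → injective (suc-injective p)
  ; sound = sound
  ; complete = complete′
  }
  where
  open Enumeration E
  complete′ : ∀ x → h (g x) ≡ true → ∃[ i ] Fin.suc (index i) ≡ x
  complete′ Fin.zero    p = ⊥-elim (not-¬ g₀ p)
  complete′ (Fin.suc x) p with complete x p
  ... | i , refl = i , refl

countB-split : ∀ {A : Set} m (g : Fin m → A) (h : A → Bool) →
  countB h (tabulate g) ℕ.+ countB (λ a → not (h a)) (tabulate g) ≡ m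
countB-split zero g h = refl
countB-split (suc m) g h with h (g Fin.zero) | countB-split m (λ i → g (Fin.suc i)) h
... | true  | split = cong suc split
... | false | split = trans (ℕP.+-suc _ _) (cong suc split)

allB-tabulate : ∀ {A : Set} m (g : Fin m → A) (f : A → Bool) →
  allB f (tabulate g) ≡ true → ∀ x → f (g x) ≡ true
allB-tabulate (suc m) g f all x with f (g Fin.zero) in g₀
allB-tabulate (suc m) g f all Fin.zero    | true = g₀
allB-tabulate (suc m) g f all (Fin.suc x) | true =
  allB-tabulate m (λ i → g (Fin.suc i)) f all x

numNonSources : ∀ {m} → Digraph m → ℕ
numNonSources {m} D = countB (λ v → not (inDeg0 D v)) (allFin m)

sources+nonSources : ∀ {m} (D : Digraph m) → numSources D ℕ.+ numNonSources D ≡ m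
sources+nonSources {m} D = countB-split m (λ v → v) (inDeg0 D)

arc⇒nonSource : ∀ {m} (D : Digraph m) y z → Arc D y z → inDeg0 D z ≡ false
arc⇒nonSource {m} D y z y→z with inDeg0 D z in source
... | false = refl
... | true  = ⊥-elim (not-¬ no-arc (cong not (Equivalence.to T-≡ y→z)))
  where
  no-arc : not (arc D y z) ≡ true
  no-arc = allB-tabulate m (λ v → v) (λ v → not (arc D v z)) source y

nonSources : ∀ {m} (D : Digraph m) →
  Enumeration m (λ v → v) (λ v → not (inDeg0 D v)) (numNonSources D)
nonSources {m} D = enumerate m (λ v → v) (λ v → not (inDeg0 D v))

adjIso-↑ˡ : ∀ {n} (G : Graph n) k x y → AdjIso G k (x ↑ˡ k) (y ↑ˡ k) ⇔ Adj G x y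
adjIso-↑ˡ {n} G k x y rewrite splitAt-↑ˡ n x k | splitAt-↑ˡ n y k =
  record { to = λ a → a ; from = λ a → a ; to-cong = λ p → p ; from-cong = λ p → p }

-- Lower bound: in any realiser, the prey sets of the non-sources (restricted to
-- V(G)) form an edge clique cover, so θ_e(G) ≤ number of non-sources.
θₑ≤nonSources : ∀ {n} (G : Graph n) k t (D : Digraph (n ℕ.+ k)) →
  IsEdgeCliqueCoverNumber G t → Realizes G k D → t ≤ numNonSources D
θₑ≤nonSources {n} G k t D (_ , minimal) (_ , competition) =
  minimal _ prey (prey-clique , prey-covers)
  where
  open Enumeration (nonSources D)
  prey : Fin (numNonSources D) → Subset n
  prey i = Vec.tabulate (λ x → arc D (x ↑ˡ k) (index i))
  prey-arc : ∀ i x → x ∈ prey i → Arc D (x ↑ˡ k) (index i)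
  prey-arc i x x∈ =
    Equivalence.from T-≡ (trans (≡-sym (lookup∘tabulate _ x)) ([]=⇒lookup x∈))
  arc-prey : ∀ i x → Arc D (x ↑ˡ k) (index i) → x ∈ prey i
  arc-prey i x x→ = lookup⇒[]= x (prey i) (trans (lookup∘tabulate _ x) (Equivalence.to T-≡ x→))
  prey-clique : ∀ i → IsClique G (prey i)
  prey-clique i x y x∈ y∈ x≢y =
    Equivalence.to (adjIso-↑ˡ G k x y) (Equivalence.to (competition (x ↑ˡ k) (y ↑ˡ k))
      ((λ eq → x≢y (↑ˡ-injective k x y eq)) , index i , prey-arc i x x∈ , prey-arc i y y∈))
  prey-covers : ∀ x y → Adj G x y → ∃[ i ] (x ∈ prey i × y ∈ prey i)
  prey-covers x y xy
    with Equivalence.from (competition (x ↑ˡ k) (y ↑ˡ k)) (Equivalence.from (adjIso-↑ˡ G k x y) xy)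
  ... | _ , z , x→z , y→z with complete z (cong not (arc⇒nonSource D _ z x→z))
  ... | i , refl = i , arc-prey i x x→z , arc-prey i y y→z

-- Upper bound: if every non-source is among w₁, …, w_t, there are at most t
-- non-sources (choosing a preimage is injective on the enumerated non-sources).
nonSources≤ : ∀ {m} t (D : Digraph m) (w : Fin t → Fin m) →
  (∀ v → (inDeg0 D v ≡ false) ⇔ (∃[ i ] w i ≡ v)) → numNonSources D ≤ t
nonSources≤ t D w nonSource⇔image = injective⇒≤ {f = preimage} preimage-injective
  where
  open Enumeration (nonSources D)
  hit : ∀ j → ∃[ i ] w i ≡ index j
  hit j = Equivalence.to (nonSource⇔image (index j)) (not-injective {y = false} (sound j))
  preimage : Fin (numNonSources D) → Fin t
  preimage j = proj₁ (hit j)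
  preimage-injective : Injective _≡_ _≡_ preimage
  preimage-injective {j} {j′} eq =
    injective (trans (≡-sym (proj₂ (hit j))) (trans (cong w eq) (proj₂ (hit j′))))

k≡t-n+p : ∀ n k p t → t ℕ.+ p ≡ n ℕ.+ k → + k ≡ (+ t - + n) + + p
k≡t-n+p n k p t eq = ≡-sym (begin
  (+ t - + n) + + p   ≡⟨ ℤP.+-assoc (+ t) (- + n) (+ p) ⟩
  + t + (- + n + + p) ≡⟨ cong (_+_ (+ t)) (ℤP.+-comm (- + n) (+ p)) ⟩
  + t + (+ p - + n)   ≡⟨ ≡-sym (ℤP.+-assoc (+ t) (+ p) (- + n)) ⟩
  + (t ℕ.+ p) - + n   ≡⟨ cong (λ z → + z - + n) (trans eq (ℕP.+-comm n k)) ⟩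
  + k + + n - + n     ≡⟨ ℤP.+-assoc (+ k) (+ n) (- + n) ⟩
  + k + (+ n - + n)   ≡⟨ cong (_+_ (+ k)) (ℤP.+-inverseʳ (+ n)) ⟩
  + k + + 0           ≡⟨ ℤP.+-identityʳ (+ k) ⟩
  + k                 ∎)
  where open ≡-Reasoning

proposition3p6 : ∀ {n} (G : Graph n) (k p t : ℕ) →
    IsCompetitionNumber G k →
    IsPrimaryPredatorIndex G k p →
    IsEdgeCliqueCoverNumber G t →
    HasEffectiveCompetitionCover G k t →
    + k ≡ (+ t - + n) + + p
proposition3p6 {n} G k p t _ ((D₀ , realizes₀ , sources₀) , p-max) θₑ
  (_ , _ , _ , _ , D , w , realizes , nonSource⇔w , _) =
  k≡t-n+p n k p t (ℕP.≤-antisym t+p≤n+k n+k≤t+p)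
  where
  open ℕP.≤-Reasoning
  t+p≤n+k : t ℕ.+ p ≤ n ℕ.+ k
  t+p≤n+k = begin
    t ℕ.+ p                               ≡⟨ ℕP.+-comm t p ⟩
    p ℕ.+ t                               ≡⟨ cong (ℕ._+ t) (≡-sym sources₀) ⟩
    numSources D₀ ℕ.+ t                   ≤⟨ ℕP.+-monoʳ-≤ _ (θₑ≤nonSources G k t D₀ θₑ realizes₀) ⟩
    numSources D₀ ℕ.+ numNonSources D₀    ≡⟨ sources+nonSources D₀ ⟩
    n ℕ.+ k                               ∎
  n+k≤t+p : n ℕ.+ k ≤ t ℕ.+ p
  n+k≤t+p = begin
    n ℕ.+ k                               ≡⟨ ≡-sym (sources+nonSources D) ⟩
    numSources D ℕ.+ numNonSources D      ≤⟨ ℕP.+-mono-≤ (p-max D realizes) (nonSources≤ t D w nonSource⇔w) ⟩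
    p ℕ.+ t                               ≡⟨ ℕP.+-comm p t ⟩
    t ℕ.+ p                               ∎
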